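{- Let $\mathfrak M=(E,\mathcal I)$ be a matroid with exchange graph $\mathcal G$ and let $(I,J)\in\mathcal I\times\mathcal I$. For every vertex $(I',J')$ in the connected component of $(I,J)$ in $\mathcal G$, one has $I\uplus J=I'\uplus J'$ and $\mathrm{MCP}(I,J)=\mathrm{MCP}(I',J')$.
   Context: $\mathrm{cl}$ denotes matroid closure. The exchange graph $\mathcal G$ has vertex set $\mathcal I\times\mathcal I$; $(I_1,I_2)$ and $(I_1',I_2')$ are adjacent if there is $i\in E$ with $i\notin I_1$, $i\in I_2$, $I_1'=I_1\cup\{i\}$, $I_2'=I_2\setminus\{i\}$, or symmetrically $i\in I_1$, $i\notin I_2$, $I_1'=I_1\setminus\{i\}$, $I_2'=I_2\cup\{i\}$. $I\uplus J$ is the multiset union. A codependent pair of $(I,J)$ is $(U,V)$ with $U\subset I$, $V\subset J$, $\mathrm{cl}(U)=\mathrm{cl}(V)$; $\mathrm{MCP}(I,J)$ is the unique inclusion-maximal codependent pair (componentwise unions of codependent pairs are codependent). -}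

module Defs where

open import Data.Nat using (ℕ; _<_; _+_)
open import Data.Bool using (Bool; true; false)
open import Data.Fin using (Fin)
open import Data.Fin.Subset using (Subset; _∈_; _∉_; _⊆_; _∪_; _-_; ⁅_⁆; ∣_∣; _─_)
open import Data.Vec using (lookup)
open import Data.Product using (Σ; ∃; _×_; _,_)
open import Level using (Level; suc; _⊔_)
open import Relation.Nullary using (¬_)
open import Relation.Binary.PropositionalEquality using (_≡_)
open import Relation.Binary.Construct.Closure.ReflexiveTransitive using (Star)

record Matroid (n : ℕ) (ℓ : Level) : Set (suc ℓ) where
  field
    Indep      : Subset n → Set ℓ
    indep-∅    : Indep (Data.Fin.Subset.⊥)
    indep-↓    : ∀ {A B} → A ⊆ B → Indep B → Indep A
    augment    : ∀ {A B} → Indep A → Indep B → ∣ A ∣ < ∣ B ∣ →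
                 Σ (Fin n) λ e → e ∈ B × e ∉ A × Indep (A ∪ ⁅ e ⁆)

module _ {n : ℕ} {ℓ : Level} (M : Matroid n ℓ) where
  open Matroid M

  -- matroid closure: e ∈ cl X iff e ∈ X, or some independent subset of X
  -- becomes dependent when e is added (equivalently r(X ∪ e) = r(X)).
  _∈cl_ : Fin n → Subset n → Set ℓ
  e ∈cl X = Level.Lift ℓ (e ∈ X) ⊎' (Σ (Subset n) λ A → A ⊆ X × Indep A × ¬ Indep (A ∪ ⁅ e ⁆))
    where open import Data.Sum renaming (_⊎_ to _⊎'_)

  SameClosure : Subset n → Subset n → Set ℓ
  SameClosure U V = ∀ e → (e ∈cl U → e ∈cl V) × (e ∈cl V → e ∈cl U)

  Codependent : Subset n → Subset n → Subset n → Subset n → Set ℓ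
  Codependent I J U V = U ⊆ I × V ⊆ J × SameClosure U V

  IsMCP : Subset n → Subset n → Subset n → Subset n → Set ℓ
  IsMCP I J U V = Codependent I J U V ×
    (∀ U' V' → U ⊆ U' → V ⊆ V' → Codependent I J U' V' → (U' ≡ U × V' ≡ V))

  Vertex : Set ℓ
  Vertex = Σ (Subset n × Subset n) λ { (A , B) → Indep A × Indep B }

  Adjacent : Vertex → Vertex → Set
  Adjacent ((I₁ , I₂) , _) ((I₁' , I₂') , _) =
    Σ (Fin n) λ i →
      (i ∉ I₁ × i ∈ I₂ × I₁' ≡ I₁ ∪ ⁅ i ⁆ × I₂' ≡ I₂ - i)
      ⊎' (i ∈ I₁ × i ∉ I₂ × I₁' ≡ I₁ - i × I₂' ≡ I₂ ∪ ⁅ i ⁆)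
    where open import Data.Sum renaming (_⊎_ to _⊎'_)

  Connected : Vertex → Vertex → Set ℓ
  Connected = Star (λ x y → Level.Lift ℓ (Adjacent x y))

-- multiplicity of e in the multiset union A ⊎ B
mult : {n : ℕ} → Subset n → Subset n → Fin n → ℕ
mult A B e = b2n (lookup A e) + b2n (lookup B e)
  where
  b2n : Bool → ℕ
  b2n true = 1
  b2n false = 0

MultisetUnionEq : {n : ℕ} → Subset n → Subset n → Subset n → Subset n → Set
MultisetUnionEq A B C D = ∀ e → mult A B e ≡ mult C D e

module Submission where

-- An edge of 𝒢 moves one element i from one side of the pair to the other,
-- and, up to swapping the two sides, it always moves i ∈ J ∖ I into I.  So a
-- relation between pairs of sets that is reflexive, transitive, stable under
-- swapping both pairs, and preserved by a single move "i from D into A" holds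
-- between any two vertices of the same connected component
-- (connected-invariant).  We apply this to two such relations:
--   * equality of multiset unions: a move only relocates the copy of i;
--   * equality of the sets of codependent pairs: if (U , V) is codependent then
--     i never lies in U or V on the wrong side, because i is not in the closure
--     of the other elements of an independent set containing it
--     (independent-∉cl); hence a move neither creates nor destroys pairs.
-- Since MCP(I , J) is defined from the codependent pairs alone, the second
-- invariant yields equality of the MCPs.

open import Defs
open import Data.Nat using (ℕ)
open import Data.Fin.Subset using (Subset)
open import Data.Product using (_×_; _,_)
open import Function.Bundles using (_⇔_)
open import Level using (Level)

open import Data.Bool using (true; false; _∨_)
open import Data.Bool.Properties using (∨-zeroʳ; ∨-identityʳ)
open import Data.Empty using (⊥-elim)
open import Data.Fin using (Fin; zero; suc; _≟_)
open import Data.Fin.Subset using (_∈_; _∉_; _⊆_; _∪_; _-_; ⁅_⁆)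
open import Data.Fin.Subset.Properties
  using (x∈⁅x⁆; x∈⁅y⁆⇒x≡y; x≢y⇒x∉⁅y⁆; p⊆p∪q; q⊆p∪q; x∈p∪q⁻; p─q⊆p; p─⊥≡p; x∈p∧x≢y⇒x∈p-y)
open import Data.Product using (proj₁; proj₂)
open import Data.Sum using (inj₁; inj₂)
open import Data.Vec using (_∷_; lookup)
open import Data.Vec.Properties using (lookup-zipWith; []=⇒lookup; lookup⇒[]=)
open import Function.Bundles using (mk⇔; Equivalence)
open import Function.Construct.Composition using (_⇔-∘_)
open import Function.Construct.Identity using (⇔-id)
open import Function.Construct.Symmetry using (⇔-sym)
open import Relation.Nullary using (¬_; yes; no)
open import Relation.Binary.PropositionalEquality
  using (_≡_; _≢_; refl; sym; trans; cong; subst)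
open import Relation.Binary.Construct.Closure.ReflexiveTransitive using (fold)

∉⇒lookup≡false : ∀ {n} {p : Subset n} {x : Fin n} → x ∉ p → lookup p x ≡ false
∉⇒lookup≡false {p = p} {x} x∉p with lookup p x in eq
... | false = refl
... | true  = ⊥-elim (x∉p (lookup⇒[]= x p eq))

lookup-add-self : ∀ {n} (p : Subset n) (i : Fin n) → lookup (p ∪ ⁅ i ⁆) i ≡ true
lookup-add-self p i
  rewrite lookup-zipWith _∨_ i p ⁅ i ⁆ | []=⇒lookup (x∈⁅x⁆ i) = ∨-zeroʳ _

lookup-add-other : ∀ {n} (p : Subset n) {i e : Fin n} → e ≢ i →
                   lookup (p ∪ ⁅ i ⁆) e ≡ lookup p e
lookup-add-other p {i} {e} e≢i
  rewrite lookup-zipWith _∨_ e p ⁅ i ⁆ | ∉⇒lookup≡false (x≢y⇒x∉⁅y⁆ e≢i) =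
  ∨-identityʳ _

lookup-remove-self : ∀ {n} (p : Subset n) (i : Fin n) → lookup (p - i) i ≡ false
lookup-remove-self (_ ∷ _) zero    = refl
lookup-remove-self (_ ∷ p) (suc i) = lookup-remove-self p i

lookup-remove-other : ∀ {n} (p : Subset n) {i e : Fin n} → e ≢ i → lookup (p - i) e ≡ lookup p e
lookup-remove-other (_ ∷ _) {zero}  {zero}  0≢0 = ⊥-elim (0≢0 refl)
lookup-remove-other (_ ∷ p) {zero}  {suc e} _   = cong (λ q → lookup q e) (p─⊥≡p p)
lookup-remove-other (_ ∷ _) {suc i} {zero}  _   = refl
lookup-remove-other (_ ∷ p) {suc i} {suc e} e≢i = lookup-remove-other p (λ e≡i → e≢i (cong suc e≡i))

x∉p-x : ∀ {n} (p : Subset n) (x : Fin n) → x ∉ p - x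
x∉p-x p x x∈p-x with () ← trans (sym ([]=⇒lookup x∈p-x)) (lookup-remove-self p x)

mult-comm : ∀ {n} (A B : Subset n) (e : Fin n) → mult A B e ≡ mult B A e
mult-comm A B e with lookup A e | lookup B e
... | false | false = refl
... | false | true  = refl
... | true  | false = refl
... | true  | true  = refl

mult-move : ∀ {n} {A B : Subset n} {i : Fin n} → i ∉ A → i ∈ B →
            MultisetUnionEq A B (A ∪ ⁅ i ⁆) (B - i)
mult-move {A = A} {B} {i} i∉A i∈B e with e ≟ i
... | yes refl
  rewrite ∉⇒lookup≡false i∉A | []=⇒lookup i∈B | lookup-add-self A i | lookup-remove-self B i = refl
... | no e≢i rewrite lookup-add-other A e≢i | lookup-remove-other B e≢i = refl

MultisetUnionEq-swap : ∀ {n} (A D A' D' : Subset n) →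
                       MultisetUnionEq D A D' A' → MultisetUnionEq A D A' D'
MultisetUnionEq-swap A D A' D' eq e =
  trans (mult-comm A D e) (trans (eq e) (mult-comm D' A' e))

module _ {n : ℕ} {ℓ : Level} (M : Matroid n ℓ) where
  open Matroid M

  side₁ side₂ : Vertex M → Subset n
  side₁ ((A , _) , _) = A
  side₂ ((_ , D) , _) = D

  module _ {p : Level} (P : Subset n → Subset n → Subset n → Subset n → Set p)
    (P-refl  : ∀ {A D} → P A D A D)
    (P-trans : ∀ {A D A' D' A'' D''} → P A D A' D' → P A' D' A'' D'' → P A D A'' D'')
    (P-swap  : ∀ {A D A' D'} → P D A D' A' → P A D A' D')
    (P-move  : ∀ {A D i} → Indep (A ∪ ⁅ i ⁆) → i ∉ A → Indep D → i ∈ D →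
               P A D (A ∪ ⁅ i ⁆) (D - i))
    where

    P̂ : Vertex M → Vertex M → Set p
    P̂ x y = P (side₁ x) (side₂ x) (side₁ y) (side₂ y)

    adjacent-invariant : ∀ x y → Adjacent M x y → P̂ x y
    adjacent-invariant ((A , D) , _ , hD) (_ , hA+i , _) (i , inj₁ (i∉A , i∈D , refl , refl)) =
      P-move hA+i i∉A hD i∈D
    adjacent-invariant ((A , D) , hA , _) (_ , _ , hD+i) (i , inj₂ (i∈A , i∉D , refl , refl)) =
      P-swap (P-move hD+i i∉D hA i∈A)

    connected-invariant : ∀ {x y} → Connected M x y → P̂ x y
    connected-invariant =
      fold P̂ (λ {x} {y} (Level.lift adj) rest → P-trans (adjacent-invariant x y adj) rest) P-refl

  multiset-union-invariant : ∀ {x y} → Connected M x y →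
                             MultisetUnionEq (side₁ x) (side₂ x) (side₁ y) (side₂ y)
  multiset-union-invariant = connected-invariant MultisetUnionEq
    (λ _ → refl) (λ eq eq' e → trans (eq e) (eq' e))
    (λ {A} {D} {A'} {D'} → MultisetUnionEq-swap A D A' D')
    (λ _ i∉A _ i∈D → mult-move i∉A i∈D)

  ∈⇒∈cl : ∀ {i U} → i ∈ U → _∈cl_ M i U
  ∈⇒∈cl i∈U = inj₁ (Level.lift i∈U)

  -- An element i of an independent set X is not spanned by any U ⊆ X avoiding
  -- i: an independent C ⊆ U with C ∪ {i} dependent would sit inside X.
  independent-∉cl : ∀ {X U : Subset n} {i} →
                    Indep X → i ∈ X → U ⊆ X → i ∉ U → ¬ _∈cl_ M i U
  independent-∉cl _ _ _ i∉U (inj₁ (Level.lift i∈U)) = i∉U i∈U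
  independent-∉cl {X} {U} {i} hX i∈X U⊆X _ (inj₂ (C , C⊆U , _ , C+i-dependent)) =
    C+i-dependent (indep-↓ C+i⊆X hX)
    where
    C+i⊆X : C ∪ ⁅ i ⁆ ⊆ X
    C+i⊆X x∈C+i with x∈p∪q⁻ C ⁅ i ⁆ x∈C+i
    ... | inj₁ x∈C   = U⊆X (C⊆U x∈C)
    ... | inj₂ x∈⁅i⁆ = subst (_∈ X) (sym (x∈⁅y⁆⇒x≡y i x∈⁅i⁆)) i∈X

  SameClosure-sym : ∀ {U V} → SameClosure M U V → SameClosure M V U
  SameClosure-sym U~V e = proj₂ (U~V e) , proj₁ (U~V e)

  -- Hence, if cl U = cl V and U lies in an independent X containing i ∉ U,
  -- then i ∉ V: otherwise i ∈ cl V = cl U.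
  same-closure-avoids : ∀ {X U V : Subset n} {i} → Indep X → i ∈ X → U ⊆ X → i ∉ U →
                        SameClosure M U V → i ∉ V
  same-closure-avoids hX i∈X U⊆X i∉U U~V i∈V =
    independent-∉cl hX i∈X U⊆X i∉U (proj₂ (U~V _) (∈⇒∈cl i∈V))

  SameCodependentPairs : Subset n → Subset n → Subset n → Subset n → Set ℓ
  SameCodependentPairs A D A' D' = ∀ U V → Codependent M A D U V ⇔ Codependent M A' D' U V

  Codependent-swap : ∀ {A D U V} → Codependent M A D U V → Codependent M D A V U
  Codependent-swap (U⊆A , V⊆D , U~V) = V⊆D , U⊆A , SameClosure-sym U~V

  -- Moving i ∈ D ∖ A from D into A, with A ∪ {i} and D independent, keeps the
  -- codependent pairs: for such a pair (U , V), i lies neither in V (before the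
  -- move, as i ∉ U ⊆ A ∪ {i}) nor in U (after the move, as i ∉ V ⊆ D).
  codependent-move : ∀ {A D : Subset n} {i} → Indep (A ∪ ⁅ i ⁆) → i ∉ A → Indep D → i ∈ D →
                     SameCodependentPairs A D (A ∪ ⁅ i ⁆) (D - i)
  codependent-move {A} {D} {i} hA+i i∉A hD i∈D U V = mk⇔ to from
    where
    to : Codependent M A D U V → Codependent M (A ∪ ⁅ i ⁆) (D - i) U V
    to (U⊆A , V⊆D , U~V) = U⊆A+i , V⊆D-i , U~V
      where
      U⊆A+i : U ⊆ A ∪ ⁅ i ⁆
      U⊆A+i x∈U = p⊆p∪q ⁅ i ⁆ (U⊆A x∈U)
      i∉V : i ∉ V
      i∉V = same-closure-avoids hA+i (q⊆p∪q A ⁅ i ⁆ (x∈⁅x⁆ i)) U⊆A+i (λ i∈U → i∉A (U⊆A i∈U)) U~V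
      V⊆D-i : V ⊆ D - i
      V⊆D-i {x} x∈V with x ≟ i
      ... | yes refl = ⊥-elim (i∉V x∈V)
      ... | no x≢i   = x∈p∧x≢y⇒x∈p-y (V⊆D x∈V) x≢i
    from : Codependent M (A ∪ ⁅ i ⁆) (D - i) U V → Codependent M A D U V
    from (U⊆A+i , V⊆D-i , U~V) = U⊆A , V⊆D , U~V
      where
      V⊆D : V ⊆ D
      V⊆D x∈V = p─q⊆p D ⁅ i ⁆ (V⊆D-i x∈V)
      i∉U : i ∉ U
      i∉U = same-closure-avoids hD i∈D V⊆D (λ i∈V → x∉p-x D i (V⊆D-i i∈V)) (SameClosure-sym U~V)
      U⊆A : U ⊆ A
      U⊆A {x} x∈U with x∈p∪q⁻ A ⁅ i ⁆ (U⊆A+i x∈U)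
      ... | inj₁ x∈A   = x∈A
      ... | inj₂ x∈⁅i⁆ = ⊥-elim (i∉U (subst (_∈ U) (x∈⁅y⁆⇒x≡y i x∈⁅i⁆) x∈U))

  codependent-pairs-invariant : ∀ {x y} → Connected M x y →
                                SameCodependentPairs (side₁ x) (side₂ x) (side₁ y) (side₂ y)
  codependent-pairs-invariant = connected-invariant SameCodependentPairs
    (λ _ _ → ⇔-id _)
    (λ same same' U V → same' U V ⇔-∘ same U V)
    (λ same U V → swap ⇔-∘ (same V U ⇔-∘ swap))
    codependent-move
    where
    swap : ∀ {A D U V} → Codependent M A D U V ⇔ Codependent M D A V U
    swap = mk⇔ Codependent-swap Codependent-swap

  IsMCP-transfer : ∀ {A D A' D'} → SameCodependentPairs A D A' D' →
                   ∀ U V → IsMCP M A D U V ⇔ IsMCP M A' D' U V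
  IsMCP-transfer same U V = mk⇔ (transfer same) (transfer (λ U V → ⇔-sym (same U V)))
    where
    transfer : ∀ {A D A' D'} → SameCodependentPairs A D A' D' →
               IsMCP M A D U V → IsMCP M A' D' U V
    transfer same (cod , maximal) =
      Equivalence.to (same U V) cod ,
      λ U' V' U⊆U' V⊆V' cod' → maximal U' V' U⊆U' V⊆V' (Equivalence.from (same U' V') cod')

proposition4p8 : {n : ℕ} {ℓ : Level} (M : Matroid n ℓ)
    (I J I' J' : Subset n)
    (hI : Matroid.Indep M I) (hJ : Matroid.Indep M J)
    (hI' : Matroid.Indep M I') (hJ' : Matroid.Indep M J') →
    Connected M ((I , J) , hI , hJ) ((I' , J') , hI' , hJ') →
    MultisetUnionEq I J I' J'
    × (∀ U V → IsMCP M I J U V ⇔ IsMCP M I' J' U V)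
proposition4p8 M I J I' J' hI hJ hI' hJ' path =
  multiset-union-invariant M path , IsMCP-transfer M (codependent-pairs-invariant M path)
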